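{- Let $d$ and $p$ be positive integers, let $G$ be a connected $\{K_{1,d},S_p,T_p\}$-free graph, and let $P$ be an induced path in $G$ on at least $dp$ vertices. Then $G-N[V(P)]$ does not contain an induced cycle of length at least $d(2p+2)$.
   Context: Graphs are finite and simple; $\mathcal{F}$-free means no induced subgraph isomorphic to a member of $\mathcal{F}$. $K_{1,d}$ is the star with $d$ leaves. $S_p$ is obtained from the claw $K_{1,3}$ by subdividing each edge $p-1$ times, and $T_p$ is the line graph of $S_p$. $N[X]$ denotes the closed neighborhood of a vertex set $X$ (the set $X$ together with all vertices adjacent to a vertex of $X$). -}

module Defs where

open import Data.Nat using (ℕ; zero; suc; _*_; _+_; _≤_)
open import Data.Fin using (Fin; zero; suc; toℕ; inject₁)
open import Data.Unit using (⊤; tt)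
open import Data.Empty using (⊥)
open import Data.Sum using (_⊎_; inj₁; inj₂)
open import Data.Product using (Σ; _×_; _,_; ∃)
open import Relation.Nullary using (¬_)
open import Relation.Binary using (Decidable)
open import Relation.Binary.PropositionalEquality using (_≡_; _≢_)
open import Relation.Binary.Construct.Closure.ReflexiveTransitive using (Star)
open import Function.Definitions using (Injective)

record Graph (n : ℕ) : Set₁ where
  field
    Adj    : Fin n → Fin n → Set
    adj?   : Decidable Adj
    sym    : ∀ {x y} → Adj x y → Adj y x
    irrefl : ∀ {x} → ¬ Adj x x
open Graph public

Connected : ∀ {n} → Graph n → Set
Connected {n} G = (u v : Fin n) → Star (Adj G) u v

InducedCopy : ∀ {n} (G : Graph n) (W : Set) (R : W → W → Set) (f : W → Fin n) → Set
InducedCopy G W R f =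
  Injective _≡_ _≡_ f ×
  (∀ i j → (R i j → Adj G (f i) (f j)) × (Adj G (f i) (f j) → R i j))

ContainsInduced : ∀ {n} → Graph n → (W : Set) → (W → W → Set) → Set
ContainsInduced {n} G W R = Σ (W → Fin n) λ f → InducedCopy G W R f

StarV : ℕ → Set
StarV d = ⊤ ⊎ Fin d

StarAdj : ∀ d → StarV d → StarV d → Set
StarAdj d (inj₁ _) (inj₂ _) = ⊤
StarAdj d (inj₂ _) (inj₁ _) = ⊤
StarAdj d _ _ = ⊥

-- S_p: claw with each edge subdivided p-1 times (3p+1 vertices).
-- Centre inj₁ tt; inj₂ (a , k) is the vertex on leg a at distance k+1
-- from the centre.

SV : ℕ → Set
SV p = ⊤ ⊎ (Fin 3 × Fin p)

par : ∀ {p} → Fin 3 × Fin p → SV p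
par {suc p} (a , zero)  = inj₁ tt
par {suc p} (a , suc k) = inj₂ (a , inject₁ k)

SAdj : ∀ p → SV p → SV p → Set
SAdj p x y =
  (Σ (Fin 3 × Fin p) λ c → y ≡ inj₂ c × par c ≡ x) ⊎
  (Σ (Fin 3 × Fin p) λ c → x ≡ inj₂ c × par c ≡ y)

-- T_p = line graph of S_p.  S_p is a tree rooted at the centre, so its
-- edges are in bijection with its non-centre vertices c, the edge of c
-- being {par c , c}.

TV : ℕ → Set
TV p = Fin 3 × Fin p

ShareEnd : ∀ p → TV p → TV p → Set
ShareEnd p c c' =
  (par c ≡ par c' ⊎ par c ≡ inj₂ c') ⊎
  (inj₂ c ≡ par c' ⊎ inj₂ {A = ⊤} c ≡ inj₂ c')

TAdj : ∀ p → TV p → TV p → Set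
TAdj p c c' = c ≢ c' × ShareEnd p c c'

PathAdj : ∀ k → Fin k → Fin k → Set
PathAdj k i j = toℕ j ≡ suc (toℕ i) ⊎ toℕ i ≡ suc (toℕ j)

-- cycle v_0 v_1 … v_{m-1} v_0  (used with m ≥ 3)
CycleAdj : ∀ m → Fin m → Fin m → Set
CycleAdj m i j =
  PathAdj m i j ⊎
  ((toℕ i ≡ 0 × suc (toℕ j) ≡ m) ⊎ (toℕ j ≡ 0 × suc (toℕ i) ≡ m))

InClosedNbhd : ∀ {n} {W : Set} (G : Graph n) → (W → Fin n) → Fin n → Set
InClosedNbhd G f v = Σ _ λ i → v ≡ f i ⊎ Adj G v (f i)

-- Take a shortest walk from P to the cycle C and let z be its second vertex.  Cut P into
-- d blocks of p vertices: by K_{1,d}-freeness the first p - 1 vertices of some block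
-- contain no neighbour of z, so P contains a p-vertex path B hanging from z (z is adjacent
-- to its first vertex only).  Walking down the shortest walk we push the current vertex in
-- front of B and drop its last vertex; minimality of the walk keeps this a pendant path,
-- and we arrive at a vertex y adjacent to C with a pendant path B anticomplete to C.
-- Cutting C into d blocks of 2p + 2 vertices, K_{1,d}-freeness again gives 2p consecutive
-- non-neighbours of y, hence two neighbours of y on C enclosing more than 2p
-- non-neighbours.  If these neighbours are far apart, the arcs of C leaving them and B form
-- an S_p centred at y; if they are adjacent, they form with y the triangle of a T_p; if y
-- has only one neighbour on C, that neighbour is the centre of an S_p.

module Submission where

open import Defs renaming (sym to adj-sym)
open import Data.Nat using (ℕ; zero; suc; _*_; _+_; _∸_; _≤_; _<_; z≤n; s≤s; _≤?_; _<?_; NonZero)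
open import Data.Nat.Properties
open import Data.Nat.DivMod
  using (_%_; _mod_; %-distribˡ-+; m<n⇒m%n≡m; m%n<n; m≤n⇒[n∸m]%m≡n%m; [m+n]%n≡m%n; n%n≡0; m%n%n≡m%n)
open import Data.Fin using (Fin; zero; suc; toℕ; fromℕ<)
open import Data.Fin.Properties
  using (toℕ-injective; toℕ<n; toℕ-fromℕ<; toℕ-inject₁; inject₁-injective; any?; all?; ¬∀⟶∃¬)
  renaming (_≟_ to _≟ᶠ_)
open import Data.Unit using (tt)
open import Data.Empty using (⊥; ⊥-elim)
open import Data.Sum using (_⊎_; inj₁; inj₂; [_,_]′)
open import Function.Base using (_∘_)
open import Data.Product using (Σ; _×_; _,_; proj₁; proj₂; swap)
open import Data.Product.Properties using (,-injective)
open import Data.Sum.Properties using (inj₂-injective)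
open import Relation.Nullary using (¬_; yes; no)
open import Relation.Nullary.Decidable using (_×-dec_)
open import Relation.Unary using (Decidable)
open import Relation.Binary.PropositionalEquality
open import Relation.Binary using (tri<; tri≈; tri>; Symmetric)
open import Relation.Binary.Construct.Closure.ReflexiveTransitive using (Star; ε; _◅_)

infixr 5 _∷_

_∷_ : ∀ {A : Set} → A → (ℕ → A) → ℕ → A
(x ∷ u) zero    = x
(x ∷ u) (suc i) = u i

-- Indices from k on carry the junk value v.
extend : ∀ {A : Set} {k} → A → (Fin k → A) → ℕ → A
extend {k = k} v P i with i <? k
... | yes i<k = P (fromℕ< i<k)
... | no  _   = v

extend-< : ∀ {A : Set} {k} (v : A) (P : Fin k → A) {i} (i<k : i < k) → extend v P i ≡ P (fromℕ< i<k)
extend-< {k = k} v P {i} i<k with i <? k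
... | yes i<k′ = cong P (toℕ-injective (trans (toℕ-fromℕ< i<k′) (sym (toℕ-fromℕ< i<k))))
... | no  i≮k  = ⊥-elim (i≮k i<k)

triple : ∀ {X : Set} → X → X → X → Fin 3 → X
triple x₀ x₁ x₂ zero             = x₀
triple x₀ x₁ x₂ (suc zero)       = x₁
triple x₀ x₁ x₂ (suc (suc zero)) = x₂

triple-all : ∀ {X : Set} (Q : X → Set) {x₀ x₁ x₂} → Q x₀ → Q x₁ → Q x₂ → ∀ a → Q (triple x₀ x₁ x₂ a)
triple-all Q q₀ q₁ q₂ zero             = q₀
triple-all Q q₀ q₁ q₂ (suc zero)       = q₁
triple-all Q q₀ q₁ q₂ (suc (suc zero)) = q₂

triple-pairwise : ∀ {X : Set} (R : X → X → Set) → Symmetric R → ∀ {x₀ x₁ x₂} → R x₀ x₁ → R x₀ x₂ → R x₁ x₂ →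
  ∀ {a b} → a ≢ b → R (triple x₀ x₁ x₂ a) (triple x₀ x₁ x₂ b)
triple-pairwise R sym-R r₀₁ r₀₂ r₁₂ {zero}           {zero}           a≢b = ⊥-elim (a≢b refl)
triple-pairwise R sym-R r₀₁ r₀₂ r₁₂ {zero}           {suc zero}       _   = r₀₁
triple-pairwise R sym-R r₀₁ r₀₂ r₁₂ {zero}           {suc (suc zero)} _   = r₀₂
triple-pairwise R sym-R r₀₁ r₀₂ r₁₂ {suc zero}       {zero}           _   = sym-R r₀₁
triple-pairwise R sym-R r₀₁ r₀₂ r₁₂ {suc zero}       {suc zero}       a≢b = ⊥-elim (a≢b refl)
triple-pairwise R sym-R r₀₁ r₀₂ r₁₂ {suc zero}       {suc (suc zero)} _   = r₁₂
triple-pairwise R sym-R r₀₁ r₀₂ r₁₂ {suc (suc zero)} {zero}           _   = sym-R r₀₂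
triple-pairwise R sym-R r₀₁ r₀₂ r₁₂ {suc (suc zero)} {suc zero}       _   = sym-R r₁₂
triple-pairwise R sym-R r₀₁ r₀₂ r₁₂ {suc (suc zero)} {suc (suc zero)} a≢b = ⊥-elim (a≢b refl)

greatest-below : ∀ {P : ℕ → Set} → Decidable P → ∀ {a s} → P a → a < s →
  Σ ℕ λ e → a ≤ e × e < s × P e × (∀ {j} → e < j → j < s → ¬ P j)
greatest-below {P} P? {a} {suc s} pa (s≤s a≤s) with P? s
... | yes ps = s , a≤s , ≤-refl , ps , λ s<j j<1+s → ⊥-elim (<-irrefl refl (<-≤-trans s<j (≤-pred j<1+s)))
... | no ¬ps with m≤n⇒m<n∨m≡n a≤s
...   | inj₂ refl = ⊥-elim (¬ps pa)
...   | inj₁ a<s with greatest-below P? pa a<s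
...     | e , a≤e , e<s , pe , above = e , a≤e , m≤n⇒m≤1+n e<s , pe , above′
  where
  above′ : ∀ {j} → e < j → j < suc s → ¬ P j
  above′ e<j j<1+s with m≤n⇒m<n∨m≡n (≤-pred j<1+s)
  ... | inj₁ j<s = above e<j j<s
  ... | inj₂ refl = ¬ps

least-from : ∀ {P : ℕ → Set} → Decidable P → ∀ k a → P (a + k) →
  Σ ℕ λ c → a ≤ c × c ≤ a + k × P c × (∀ {j} → a ≤ j → j < c → ¬ P j)
least-from P? k a pak with P? a
... | yes pa = a , ≤-refl , m≤m+n a k , pa , λ a≤j j<a → ⊥-elim (<-irrefl refl (<-≤-trans j<a a≤j))
least-from {P} P? zero a pak | no ¬pa = ⊥-elim (¬pa (subst P (+-identityʳ a) pak))
least-from {P} P? (suc k) a pak | no ¬pa with least-from P? k (suc a) (subst P (+-suc a k) pak)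
... | c , a<c , c≤ , pc , below = c , <⇒≤ a<c , ≤-trans c≤ (≤-reflexive (sym (+-suc a k))) , pc , below′
  where
  below′ : ∀ {j} → a ≤ j → j < c → ¬ P j
  below′ a≤j j<c with m≤n⇒m<n∨m≡n a≤j
  ... | inj₁ a<j = below a<j j<c
  ... | inj₂ refl = ¬pa

least-in-range : ∀ {P : ℕ → Set} → Decidable P → ∀ {a s} → P s → a ≤ s →
  Σ ℕ λ c → a ≤ c × c ≤ s × P c × (∀ {j} → a ≤ j → j < c → ¬ P j)
least-in-range {P} P? {a} {s} ps a≤s with least-from P? (s ∸ a) a (subst P (sym (m+[n∸m]≡n a≤s)) ps)
... | c , a≤c , c≤ , pc , below = c , a≤c , subst (c ≤_) (m+[n∸m]≡n a≤s) c≤ , pc , below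

in-window : ∀ (P : ℕ → Set) {a ℓ} → (∀ {t} → t < ℓ → ¬ P (a + t)) → ∀ {x} → a ≤ x → x < a + ℓ → ¬ P x
in-window P {a} {ℓ} window {x} a≤x x<a+ℓ = subst (λ y → ¬ P y) (m+[n∸m]≡n a≤x)
  (window (+-cancelˡ-< a _ _ (subst (_< a + ℓ) (sym (m+[n∸m]≡n a≤x)) x<a+ℓ)))

enclosing-gap : ∀ {P : ℕ → Set} → Decidable P → ∀ {a ℓ N} → P 0 → P N →
  (∀ {t} → t < ℓ → ¬ P (a + t)) → 0 < a → a + ℓ ≤ N →
  Σ ℕ λ e → Σ ℕ λ M → P e × P (e + M) × ℓ < M × e + M ≤ N × (∀ {i} → 0 < i → i < M → ¬ P (e + i))
enclosing-gap {P} P? {a} {ℓ} {N} p₀ p_N window 0<a a+ℓ≤N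
  with greatest-below P? p₀ 0<a | least-in-range P? p_N a+ℓ≤N
... | e , _ , e<a , p_e , none-above | c , a+ℓ≤c , c≤N , p_c , none-below =
      e , c ∸ e , p_e , subst P (sym e+M≡c) p_c , ℓ<M , ≤-trans (≤-reflexive e+M≡c) c≤N , gap
  where
  e≤c : e ≤ c
  e≤c = ≤-trans (<⇒≤ e<a) (≤-trans (m≤m+n a ℓ) a+ℓ≤c)
  e+M≡c : e + (c ∸ e) ≡ c
  e+M≡c = m+[n∸m]≡n e≤c
  ℓ<M : ℓ < c ∸ e
  ℓ<M = m+n≤o⇒m≤o∸n (suc ℓ) (subst (_≤ c) (cong suc (+-comm e ℓ)) (≤-trans (+-monoˡ-≤ ℓ e<a) a+ℓ≤c))
  gap : ∀ {i} → 0 < i → i < c ∸ e → ¬ P (e + i)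
  gap {i} 0<i i<M with e + i <? a | e + i <? a + ℓ
  ... | yes e+i<a | _          = none-above (m<m+n e 0<i) e+i<a
  ... | no  e+i≮a | yes e+i<a+ℓ = in-window P window (≮⇒≥ e+i≮a) e+i<a+ℓ
  ... | no  _     | no  e+i≮a+ℓ = none-below (≮⇒≥ e+i≮a+ℓ) (subst (e + i <_) e+M≡c (+-monoʳ-< e i<M))

toℕ+0-mod : ∀ {m} (i : Fin (suc m)) → (toℕ i + 0) mod suc m ≡ i
toℕ+0-mod {m} i = toℕ-injective
  (trans (toℕ-fromℕ< _) (trans (cong (_% suc m) (+-identityʳ (toℕ i))) (m<n⇒m%n≡m (toℕ<n i))))

[r+t]%m≡r⇒t≡0 : ∀ {m} .{{_ : NonZero m}} {r t} → r < m → t < m → (r + t) % m ≡ r → t ≡ 0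
[r+t]%m≡r⇒t≡0 {m} {r} {t} r<m t<m e with r + t <? m
... | yes r+t<m = +-cancelˡ-≡ r t 0 (trans (trans (sym (m<n⇒m%n≡m r+t<m)) e) (sym (+-identityʳ r)))
... | no  r+t≮m = ⊥-elim (<-irrefl (+-cancelˡ-≡ r t m r+t≡r+m) t<m)
  where
  m≤r+t : m ≤ r + t
  m≤r+t = ≮⇒≥ r+t≮m
  r+t∸m<m : r + t ∸ m < m
  r+t∸m<m = +-cancelʳ-< _ _ _ (subst (_< m + m) (sym (m∸n+n≡m m≤r+t)) (+-mono-< r<m t<m))
  r+t≡r+m : r + t ≡ r + m
  r+t≡r+m = begin
    r + t           ≡⟨ sym (m∸n+n≡m m≤r+t) ⟩
    (r + t ∸ m) + m ≡⟨ cong (_+ m) (sym (m<n⇒m%n≡m r+t∸m<m)) ⟩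
    (r + t ∸ m) % m + m ≡⟨ cong (_+ m) (trans (m≤n⇒[n∸m]%m≡n%m m≤r+t) e) ⟩
    r + m           ∎
    where open ≡-Reasoning

%-absorbˡ : ∀ {m} .{{_ : NonZero m}} x y → (x % m + y) % m ≡ (x + y) % m
%-absorbˡ {m} x y = begin
  (x % m + y) % m         ≡⟨ %-distribˡ-+ (x % m) y m ⟩
  (x % m % m + y % m) % m ≡⟨ cong (λ t → (t + y % m) % m) (m%n%n≡m%n x m) ⟩
  (x % m + y % m) % m     ≡⟨ sym (%-distribˡ-+ x y m) ⟩
  (x + y) % m             ∎
  where open ≡-Reasoning

%-distance-zero : ∀ {m} .{{_ : NonZero m}} q {x y} → x ≤ y → y < m → (q + y) % m ≡ (q + x) % m → y ≡ x
%-distance-zero {m} q {x} {y} x≤y y<m e =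
  ≤-antisym (m∸n≡0⇒m≤n ([r+t]%m≡r⇒t≡0 (m%n<n (q + x) m) (≤-<-trans (m∸n≤m y x) y<m) shifted)) x≤y
  where
  open ≡-Reasoning
  shifted : ((q + x) % m + (y ∸ x)) % m ≡ (q + x) % m
  shifted = begin
    ((q + x) % m + (y ∸ x)) % m       ≡⟨ %-absorbˡ (q + x) (y ∸ x) ⟩
    (q + x + (y ∸ x)) % m             ≡⟨ cong (_% m) (trans (+-assoc q x (y ∸ x)) (cong (q +_) (m+[n∸m]≡n x≤y))) ⟩
    (q + y) % m                       ≡⟨ e ⟩
    (q + x) % m                       ∎

%-injective-window : ∀ {m} .{{_ : NonZero m}} q {x y} → x < m → y < m → (q + x) % m ≡ (q + y) % m → x ≡ y
%-injective-window q {x} {y} x<m y<m e with ≤-total x y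
... | inj₁ x≤y = sym (%-distance-zero q x≤y y<m (sym e))
... | inj₂ y≤x = %-distance-zero q y≤x x<m e

module _ {n : ℕ} (G : Graph n) where

  record IsInducedPath (u : ℕ → Fin n) (L : ℕ) : Set where
    field
      adj⇒next  : ∀ {i j} → i < L → j < L → Adj G (u i) (u j) → j ≡ suc i ⊎ i ≡ suc j
      next⇒adj  : ∀ {i} → suc i < L → Adj G (u i) (u (suc i))
      injective : ∀ {i j} → i < L → j < L → u i ≡ u j → i ≡ j

  open IsInducedPath public

  nonconsecutive⇒¬adj : ∀ {u L} → IsInducedPath u L → ∀ {i j} → suc i < j → j < L → ¬ Adj G (u i) (u j)
  nonconsecutive⇒¬adj path si<j j<L a with adj⇒next path (<-trans (n<1+n _) (<-trans si<j j<L)) j<L a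
  ... | inj₁ refl = <-irrefl refl si<j
  ... | inj₂ refl = <-asym si<j (s≤s (n≤1+n _))

  index<⇒≢ : ∀ {u L} → IsInducedPath u L → ∀ {i j} → i < j → j < L → u i ≢ u j
  index<⇒≢ path i<j j<L e = <-irrefl (injective path (<-trans i<j j<L) j<L e) i<j

  resp-≗ : ∀ {u v L} → u ≗ v → IsInducedPath u L → IsInducedPath v L
  resp-≗ {u} {v} u≗v path = record
    { adj⇒next  = λ i< j< a → adj⇒next path i< j< (subst₂ (Adj G) (sym (u≗v _)) (sym (u≗v _)) a)
    ; next⇒adj  = λ si< → subst₂ (Adj G) (u≗v _) (u≗v _) (next⇒adj path si<)
    ; injective = λ i< j< e → injective path i< j< (trans (u≗v _) (trans e (sym (u≗v _))))
    }

  restrict : ∀ {u L L′} → L′ ≤ L → IsInducedPath u L → IsInducedPath u L′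
  restrict L′≤L path = record
    { adj⇒next  = λ i< j< → adj⇒next path (<-≤-trans i< L′≤L) (<-≤-trans j< L′≤L)
    ; next⇒adj  = λ si< → next⇒adj path (<-≤-trans si< L′≤L)
    ; injective = λ i< j< → injective path (<-≤-trans i< L′≤L) (<-≤-trans j< L′≤L)
    }

  drop : ∀ {u M} r {L} → r + L ≤ M → IsInducedPath u M → IsInducedPath (λ k → u (r + k)) L
  drop {u} {M} r {L} r+L≤M path = record
    { adj⇒next  = λ i< j< a → shift-back (adj⇒next path (inside i<) (inside j<) a)
    ; next⇒adj  = λ {i} si< → subst (λ t → Adj G (u (r + i)) (u t)) (sym (+-suc r i))
                                 (next⇒adj path (subst (_< M) (+-suc r i) (inside si<)))
    ; injective = λ i< j< e → +-cancelˡ-≡ r _ _ (injective path (inside i<) (inside j<) e)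
    }
    where
    inside : ∀ {i} → i < L → r + i < M
    inside i< = <-≤-trans (+-monoʳ-< r i<) r+L≤M
    shift-back : ∀ {i j} → r + j ≡ suc (r + i) ⊎ r + i ≡ suc (r + j) → j ≡ suc i ⊎ i ≡ suc j
    shift-back {i} {j} (inj₁ e) = inj₁ (+-cancelˡ-≡ r j (suc i) (trans e (sym (+-suc r i))))
    shift-back {i} {j} (inj₂ e) = inj₂ (+-cancelˡ-≡ r i (suc j) (trans e (sym (+-suc r j))))

  reverse : ∀ {u M} r → suc r ≤ M → IsInducedPath u M → IsInducedPath (λ k → u (r ∸ k)) (suc r)
  reverse {u} {M} r r<M path = record
    { adj⇒next  = λ { {i} {j} (s≤s i≤) (s≤s j≤) a → flip i≤ j≤ (adj⇒next path (inside i) (inside j) a) }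
    ; next⇒adj  = λ { {i} (s≤s si≤) → subst (λ t → Adj G (u t) (u (r ∸ suc i))) (sym (r∸i≡1+r∸1+i si≤))
                                         (adj-sym G (next⇒adj path (subst (_< M) (r∸i≡1+r∸1+i si≤) (inside i)))) }
    ; injective = λ { {i} {j} (s≤s i≤) (s≤s j≤) e → ∸-cancelˡ-≡ i≤ j≤ (injective path (inside i) (inside j) e) }
    }
    where
    inside : ∀ i → r ∸ i < M
    inside i = ≤-<-trans (m∸n≤m r i) r<M
    r∸i≡1+r∸1+i : ∀ {i} → suc i ≤ r → r ∸ i ≡ suc (r ∸ suc i)
    r∸i≡1+r∸1+i si≤r = +-∸-assoc 1 si≤r
    next-back : ∀ {i j} → i ≤ r → j ≤ r → r ∸ j ≡ suc (r ∸ i) → i ≡ suc j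
    next-back {zero}  {j} _   j≤ e = ⊥-elim (<-irrefl e (s≤s (m∸n≤m r j)))
    next-back {suc i} {j} si≤ j≤ e =
      cong suc (sym (∸-cancelˡ-≡ j≤ (<⇒≤ si≤) (trans e (sym (r∸i≡1+r∸1+i si≤)))))
    flip : ∀ {i j} → i ≤ r → j ≤ r → r ∸ j ≡ suc (r ∸ i) ⊎ r ∸ i ≡ suc (r ∸ j) → j ≡ suc i ⊎ i ≡ suc j
    flip i≤ j≤ (inj₁ e) = inj₂ (next-back i≤ j≤ e)
    flip i≤ j≤ (inj₂ e) = inj₁ (next-back j≤ i≤ e)

  prepend : ∀ {u L} z → IsInducedPath u L → Adj G z (u 0) →
            (∀ {k} → suc k < L → ¬ Adj G z (u (suc k))) → (∀ {k} → k < L → z ≢ u k) →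
            IsInducedPath (z ∷ u) (suc L)
  prepend {u} {L} z path z~u₀ z≁u z∉u = record { adj⇒next = adj ; next⇒adj = next ; injective = inj }
    where
    adj : ∀ {i j} → i < suc L → j < suc L → Adj G ((z ∷ u) i) ((z ∷ u) j) → j ≡ suc i ⊎ i ≡ suc j
    adj {zero}        {zero}        _         _         a = ⊥-elim (irrefl G a)
    adj {zero}        {suc zero}    _         _         a = inj₁ refl
    adj {zero}        {suc (suc j)} _         (s≤s j<)  a = ⊥-elim (z≁u j< a)
    adj {suc zero}    {zero}        _         _         a = inj₂ refl
    adj {suc (suc i)} {zero}        (s≤s i<)  _         a = ⊥-elim (z≁u i< (adj-sym G a))
    adj {suc i}       {suc j}       (s≤s i<)  (s≤s j<)  a with adj⇒next path i< j< a
    ... | inj₁ e = inj₁ (cong suc e)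
    ... | inj₂ e = inj₂ (cong suc e)
    next : ∀ {i} → suc i < suc L → Adj G ((z ∷ u) i) ((z ∷ u) (suc i))
    next {zero}  _          = z~u₀
    next {suc i} (s≤s si<) = next⇒adj path si<
    inj : ∀ {i j} → i < suc L → j < suc L → (z ∷ u) i ≡ (z ∷ u) j → i ≡ j
    inj {zero}  {zero}  _        _        _ = refl
    inj {zero}  {suc j} _        (s≤s j<) e = ⊥-elim (z∉u j< e)
    inj {suc i} {zero}  (s≤s i<) _        e = ⊥-elim (z∉u i< (sym e))
    inj {suc i} {suc j} (s≤s i<) (s≤s j<) e = cong suc (injective path i< j< e)

  copy⇒path : ∀ {k} {P : Fin k → Fin n} v → InducedCopy G (Fin k) (PathAdj k) P → IsInducedPath (extend v P) k
  copy⇒path {k} {P} v (P-inj , P-adj) = record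
    { adj⇒next  = λ i<k j<k a → [ inj₁ ∘ index i<k j<k , inj₂ ∘ index j<k i<k ]′
                                  (proj₂ (P-adj _ _) (subst₂ (Adj G) (extend-< v P i<k) (extend-< v P j<k) a))
    ; next⇒adj  = λ {i} 1+i<k → subst₂ (Adj G) (sym (extend-< v P (<-trans (n<1+n i) 1+i<k))) (sym (extend-< v P 1+i<k))
                                  (proj₁ (P-adj _ _) (inj₁ (trans (toℕ-fromℕ< 1+i<k) (cong suc (sym (toℕ-fromℕ< _))))))
    ; injective = λ i<k j<k e → trans (sym (toℕ-fromℕ< i<k)) (trans (cong toℕ (P-inj
                    (trans (sym (extend-< v P i<k)) (trans e (extend-< v P j<k))))) (toℕ-fromℕ< j<k))
    }
    where
    index : ∀ {i j} (i<k : i < k) (j<k : j < k) → toℕ (fromℕ< j<k) ≡ suc (toℕ (fromℕ< i<k)) → j ≡ suc i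
    index i<k j<k e = trans (sym (toℕ-fromℕ< j<k)) (trans e (cong suc (toℕ-fromℕ< i<k)))

  -- The forbidden induced subgraphs

  star : ∀ d z (ℓ : Fin d → Fin n) → (∀ i → Adj G z (ℓ i)) → (∀ i j → ¬ Adj G (ℓ i) (ℓ j)) →
         (∀ {i j} → ℓ i ≡ ℓ j → i ≡ j) → ContainsInduced G (StarV d) (StarAdj d)
  star d z ℓ z~ℓ ℓ≁ℓ ℓ-inj = f , inj , λ x y → to x y , from x y
    where
    f : StarV d → Fin n
    f (inj₁ _) = z
    f (inj₂ i) = ℓ i
    inj : ∀ {x y} → f x ≡ f y → x ≡ y
    inj {inj₁ _} {inj₁ _} e = refl
    inj {inj₁ _} {inj₂ j} e = ⊥-elim (irrefl G (subst (Adj G z) (sym e) (z~ℓ j)))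
    inj {inj₂ i} {inj₁ _} e = ⊥-elim (irrefl G (subst (Adj G z) e (z~ℓ i)))
    inj {inj₂ i} {inj₂ j} e = cong inj₂ (ℓ-inj e)
    to : ∀ x y → StarAdj d x y → Adj G (f x) (f y)
    to (inj₁ _) (inj₂ j) _ = z~ℓ j
    to (inj₂ i) (inj₁ _) _ = adj-sym G (z~ℓ i)
    from : ∀ x y → Adj G (f x) (f y) → StarAdj d x y
    from (inj₁ _) (inj₁ _) a = irrefl G a
    from (inj₁ _) (inj₂ _) _ = tt
    from (inj₂ _) (inj₁ _) _ = tt
    from (inj₂ i) (inj₂ j) a = ℓ≁ℓ i j a

  Separated : ℕ → (ℕ → Fin n) → (ℕ → Fin n) → Set
  Separated p A B = ∀ {k j} → k < p → j < p → A k ≢ B j × ¬ Adj G (A k) (B j)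

  separated-sym : ∀ {p A B} → Separated p A B → Separated p B A
  separated-sym sep k< j< = (λ e → proj₁ (sep j< k<) (sym e)) , (λ a → proj₂ (sep j< k<) (adj-sym G a))

  par-of-next : ∀ {p} a (j k : Fin p) → toℕ j ≡ suc (toℕ k) → par (a , j) ≡ inj₂ (a , k)
  par-of-next a zero    k ()
  par-of-next a (suc j) k e =
    cong (λ t → inj₂ (a , t)) (toℕ-injective (trans (toℕ-inject₁ j) (suc-injective e)))

  spider : ∀ {p} z (A B C : ℕ → Fin n) →
    IsInducedPath (z ∷ A) (suc p) → IsInducedPath (z ∷ B) (suc p) → IsInducedPath (z ∷ C) (suc p) →
    Separated p A B → Separated p A C → Separated p B C → ContainsInduced G (SV p) (SAdj p)
  spider {p} z A B C pathA pathB pathC sepAB sepAC sepBC = f , inj , λ x y → to x y , from x y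
    where
    leg : Fin 3 → ℕ → Fin n
    leg = triple A B C
    leg-path : ∀ a → IsInducedPath (z ∷ leg a) (suc p)
    leg-path = triple-all (λ L → IsInducedPath (z ∷ L) (suc p)) pathA pathB pathC
    legs-separated : ∀ {a b} → a ≢ b → Separated p (leg a) (leg b)
    legs-separated = triple-pairwise (Separated p) separated-sym sepAB sepAC sepBC

    depth< : (k : Fin p) → suc (toℕ k) < suc p
    depth< k = s≤s (toℕ<n k)

    f : SV p → Fin n
    f (inj₁ _)       = z
    f (inj₂ (a , k)) = leg a (toℕ k)

    inj : ∀ {x y} → f x ≡ f y → x ≡ y
    inj {inj₁ _}       {inj₁ _}       _ = refl
    inj {inj₁ _}       {inj₂ (b , j)} e with injective (leg-path b) (s≤s z≤n) (depth< j) e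
    ... | ()
    inj {inj₂ (a , k)} {inj₁ _}       e with injective (leg-path a) (depth< k) (s≤s z≤n) e
    ... | ()
    inj {inj₂ (a , k)} {inj₂ (b , j)} e with a ≟ᶠ b
    ... | yes refl = cong (λ t → inj₂ (a , t))
                       (toℕ-injective (suc-injective (injective (leg-path a) (depth< k) (depth< j) e)))
    ... | no a≢b   = ⊥-elim (proj₁ (legs-separated a≢b (toℕ<n k) (toℕ<n j)) e)

    par-adj : ∀ c → Adj G (f (par c)) (f (inj₂ c))
    par-adj (a , zero)  = next⇒adj (leg-path a) (s≤s (s≤s z≤n))
    par-adj (a , suc k) rewrite toℕ-inject₁ k = next⇒adj (leg-path a) (depth< (suc k))

    to : ∀ x y → SAdj p x y → Adj G (f x) (f y)
    to _ _ (inj₁ (c , refl , refl)) = par-adj c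
    to _ _ (inj₂ (c , refl , refl)) = adj-sym G (par-adj c)

    from-centre : ∀ a k → Adj G z (leg a (toℕ k)) → par (a , k) ≡ inj₁ tt
    from-centre a k zk with adj⇒next (leg-path a) (s≤s z≤n) (depth< k) zk
    from-centre a zero zk | inj₁ refl = refl

    from : ∀ x y → Adj G (f x) (f y) → SAdj p x y
    from (inj₁ _)       (inj₁ _)       zz = ⊥-elim (irrefl G zz)
    from (inj₁ _)       (inj₂ c)       zc = inj₁ (c , refl , from-centre _ _ zc)
    from (inj₂ c)       (inj₁ _)       cz = inj₂ (c , refl , from-centre _ _ (adj-sym G cz))
    from (inj₂ (a , k)) (inj₂ (b , j)) kj with a ≟ᶠ b
    ... | no a≢b   = ⊥-elim (proj₂ (legs-separated a≢b (toℕ<n k) (toℕ<n j)) kj)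
    ... | yes refl with adj⇒next (leg-path a) (depth< k) (depth< j) kj
    ...   | inj₁ e = inj₁ ((a , j) , refl , par-of-next a j k (suc-injective e))
    ...   | inj₂ e = inj₂ ((a , k) , refl , par-of-next a k j (suc-injective e))

  Linked : ℕ → (ℕ → Fin n) → (ℕ → Fin n) → Set
  Linked p A B = Adj G (A 0) (B 0) ×
    (∀ {k j} → k < p → j < p → A k ≢ B j × (Adj G (A k) (B j) → k ≡ 0 × j ≡ 0))

  linked-sym : ∀ {p A B} → Linked p A B → Linked p B A
  linked-sym (roots , link) = adj-sym G roots , λ k< j< →
    (λ e → proj₁ (link j< k<) (sym e)) , (λ a → swap (proj₂ (link j< k<) (adj-sym G a)))

  par-injective : ∀ {p} a b (k j : Fin p) → par (a , suc k) ≡ par (b , suc j) → (a , suc k) ≡ (b , suc j)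
  par-injective a b k j e with ,-injective (inj₂-injective e)
  ... | refl , ek = cong (λ t → a , suc t) (inject₁-injective ek)

  triangle : ∀ {p} (A B C : ℕ → Fin n) →
    IsInducedPath A p → IsInducedPath B p → IsInducedPath C p →
    Linked p A B → Linked p A C → Linked p B C → ContainsInduced G (TV p) (TAdj p)
  triangle {p} A B C pathA pathB pathC linkAB linkAC linkBC = f , inj , λ x y → to x y , from x y
    where
    leg : Fin 3 → ℕ → Fin n
    leg = triple A B C
    leg-path : ∀ a → IsInducedPath (leg a) p
    leg-path = triple-all (λ L → IsInducedPath L p) pathA pathB pathC
    legs-linked : ∀ {a b} → a ≢ b → Linked p (leg a) (leg b)
    legs-linked = triple-pairwise (Linked p) linked-sym linkAB linkAC linkBC

    f : TV p → Fin n
    f (a , k) = leg a (toℕ k)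

    inj : ∀ {x y} → f x ≡ f y → x ≡ y
    inj {a , k} {b , j} e with a ≟ᶠ b
    ... | yes refl = cong (a ,_) (toℕ-injective (injective (leg-path a) (toℕ<n k) (toℕ<n j) e))
    ... | no a≢b   = ⊥-elim (proj₁ (proj₂ (legs-linked a≢b) (toℕ<n k) (toℕ<n j)) e)

    to-parent : ∀ c c′ → par c ≡ inj₂ c′ → Adj G (f c) (f c′)
    to-parent (a , suc k) _ refl rewrite toℕ-inject₁ k = adj-sym G (next⇒adj (leg-path a) (toℕ<n (suc k)))

    to : ∀ c c′ → TAdj p c c′ → Adj G (f c) (f c′)
    to (a , zero)  (b , zero)  (c≢c′ , inj₁ (inj₁ _)) with a ≟ᶠ b
    ... | yes refl = ⊥-elim (c≢c′ refl)
    ... | no a≢b   = proj₁ (legs-linked a≢b)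
    to (a , suc k) (b , suc j) (c≢c′ , inj₁ (inj₁ e))   = ⊥-elim (c≢c′ (par-injective a b k j e))
    to c           c′          (_    , inj₁ (inj₂ e))   = to-parent c c′ e
    to c           c′          (_    , inj₂ (inj₁ e))   = adj-sym G (to-parent c′ c (sym e))
    to c           c′          (c≢c′ , inj₂ (inj₂ e))   = ⊥-elim (c≢c′ (inj₂-injective e))

    from : ∀ c c′ → Adj G (f c) (f c′) → TAdj p c c′
    from c c′ a = (λ { refl → irrefl G a }) , share c c′ a
      where
      share : ∀ c c′ → Adj G (f c) (f c′) → ShareEnd p c c′
      share (a , k) (b , j) kj with a ≟ᶠ b
      ... | yes refl with adj⇒next (leg-path a) (toℕ<n k) (toℕ<n j) kj
      ...   | inj₁ e = inj₂ (inj₁ (sym (par-of-next a j k e)))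
      ...   | inj₂ e = inj₁ (inj₂ (par-of-next a k j e))
      share (a , k) (b , j) kj | no a≢b with proj₂ (proj₂ (legs-linked a≢b) (toℕ<n k) (toℕ<n j)) kj
      share (a , zero) (b , zero) kj | no _ | _ = inj₁ (inj₁ refl)

  -- Pendant paths inside a long induced path

  neighbour-free-block : ∀ {d w o ℓ L u} z → ¬ ContainsInduced G (StarV d) (StarAdj d) →
    IsInducedPath u L → o + ℓ < w → d * w ≤ suc L →
    Σ ℕ λ b → b < d × (∀ {t} → t < ℓ → ¬ Adj G z (u (b * w + o + t)))
  neighbour-free-block {d} {w} {o} {ℓ} {L} {u} z no-star path o+ℓ<w dw≤1+L
    with all? (λ b → any? (λ t → adj? G z (u (toℕ b * w + o + toℕ t))))
  ... | yes hit = ⊥-elim (no-star (star d z leaf (λ b → proj₂ (hit b)) independent distinct))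
    where
    pos : ℕ → ℕ → ℕ
    pos b t = b * w + o + t
    before-next-block : ∀ b {t} → t < ℓ → suc (pos b t) < suc b * w
    before-next-block b {t} t<ℓ = begin-strict
      suc (b * w + o + t)   ≡⟨ cong suc (+-assoc (b * w) o t) ⟩
      suc (b * w + (o + t)) ≡⟨ sym (+-suc (b * w) (o + t)) ⟩
      b * w + suc (o + t)   ≤⟨ +-monoʳ-≤ (b * w) (+-monoʳ-< o t<ℓ) ⟩
      b * w + (o + ℓ)       <⟨ +-monoʳ-< (b * w) o+ℓ<w ⟩
      b * w + w             ≡⟨ +-comm (b * w) w ⟩
      suc b * w             ∎
      where open ≤-Reasoning
    t : Fin d → ℕ
    t b = toℕ (proj₁ (hit b))
    at : Fin d → ℕ
    at b = pos (toℕ b) (t b)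
    leaf : Fin d → Fin n
    leaf b = u (at b)
    at<L : ∀ b → at b < L
    at<L b = ≤-pred (<-≤-trans (before-next-block (toℕ b) (toℕ<n (proj₁ (hit b))))
                               (≤-trans (*-monoˡ-≤ w (toℕ<n b)) dw≤1+L))
    spaced : ∀ {b b′} → toℕ b < toℕ b′ → suc (at b) < at b′
    spaced {b} {b′} b<b′ = <-≤-trans (before-next-block (toℕ b) (toℕ<n (proj₁ (hit b))))
      (≤-trans (*-monoˡ-≤ w b<b′) (≤-trans (m≤m+n (toℕ b′ * w) o) (m≤m+n _ (t b′))))
    independent : ∀ b b′ → ¬ Adj G (leaf b) (leaf b′)
    independent b b′ with <-cmp (toℕ b) (toℕ b′)
    ... | tri< b<b′ _ _ = nonconsecutive⇒¬adj path (spaced b<b′) (at<L b′)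
    ... | tri> _ _ b′<b = λ a → nonconsecutive⇒¬adj path (spaced b′<b) (at<L b) (adj-sym G a)
    ... | tri≈ _ b≡b′ _ rewrite toℕ-injective b≡b′ = irrefl G
    distinct : ∀ {b b′} → leaf b ≡ leaf b′ → b ≡ b′
    distinct {b} {b′} e with <-cmp (toℕ b) (toℕ b′)
    ... | tri< b<b′ _ _ = ⊥-elim (index<⇒≢ path (<-trans (n<1+n _) (spaced b<b′)) (at<L b′) e)
    ... | tri> _ _ b′<b = ⊥-elim (index<⇒≢ path (<-trans (n<1+n _) (spaced b′<b)) (at<L b) (sym e))
    ... | tri≈ _ b≡b′ _ = toℕ-injective b≡b′
  ... | no miss with ¬∀⟶∃¬ d _ (λ b → any? (λ t → adj? G z (u (toℕ b * w + o + toℕ t)))) miss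
  ...   | b , none = toℕ b , toℕ<n b , λ {t} t<ℓ a →
            none (fromℕ< t<ℓ , subst (λ i → Adj G z (u (toℕ b * w + o + i))) (sym (toℕ-fromℕ< t<ℓ)) a)

  OnPath : (ℕ → Fin n) → ℕ → Fin n → Set
  OnPath u L v = Σ ℕ λ x → x < L × v ≡ u x

  Leg : Fin n → (ℕ → Fin n) → ℕ → (ℕ → Fin n) → ℕ → Set
  Leg z B p u L = IsInducedPath (z ∷ B) (suc p) × (∀ {j} → j < p → OnPath u L (B j))

  leg-after-window : ∀ {u L z a ℓ i} → IsInducedPath u L → (∀ {x} → x < L → z ≢ u x) →
    (∀ {t} → t < ℓ → ¬ Adj G z (u (a + t))) → a + ℓ ≤ i → i < L → Adj G z (u i) →
    Σ (ℕ → Fin n) λ B → Leg z B (suc ℓ) u L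
  leg-after-window {u} {L} {z} {a} {ℓ} {i} path z∉u window a+ℓ≤i i<L z~uᵢ
    with least-in-range (λ x → adj? G z (u x)) z~uᵢ a+ℓ≤i
  ... | r , a+ℓ≤r , r≤i , z~uᵣ , none-below =
        (λ k → u (r ∸ k)) , prepend z (restrict (s≤s ℓ≤r) (reverse r r<L path)) z~uᵣ z≁ z∉ , on-path
    where
    r<L : r < L
    r<L = ≤-<-trans r≤i i<L
    ℓ≤r : ℓ ≤ r
    ℓ≤r = ≤-trans (m≤n+m ℓ a) a+ℓ≤r
    z≁ : ∀ {k} → suc k < suc ℓ → ¬ Adj G z (u (r ∸ suc k))
    z≁ {k} (s≤s k<ℓ) with a + ℓ ≤? r ∸ suc k
    ... | yes a+ℓ≤ = none-below a+ℓ≤ (∸-monoʳ-< (s≤s z≤n) (≤-trans k<ℓ ℓ≤r))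
    ... | no  a+ℓ≰ = in-window (λ x → Adj G z (u x)) window
                       (m+n≤o⇒m≤o∸n a (≤-trans (+-monoʳ-≤ a k<ℓ) a+ℓ≤r)) (≰⇒> a+ℓ≰)
    z∉ : ∀ {k} → k < suc ℓ → z ≢ u (r ∸ k)
    z∉ {k} _ = z∉u (≤-<-trans (m∸n≤m r k) r<L)
    on-path : ∀ {j} → j < suc ℓ → OnPath u L (u (r ∸ j))
    on-path {j} _ = r ∸ j , ≤-<-trans (m∸n≤m r j) r<L , refl

  leg-before-window : ∀ {u L z a ℓ i} → IsInducedPath u L → (∀ {x} → x < L → z ≢ u x) →
    (∀ {t} → t < ℓ → ¬ Adj G z (u (a + t))) → a + ℓ ≤ L → i < a → Adj G z (u i) →
    Σ (ℕ → Fin n) λ B → Leg z B (suc ℓ) u L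
  leg-before-window {u} {L} {z} {a} {ℓ} {i} path z∉u window a+ℓ≤L i<a z~uᵢ
    with greatest-below (λ x → adj? G z (u x)) z~uᵢ i<a
  ... | r , i≤r , r<a , z~uᵣ , none-above =
        (λ k → u (r + k)) ,
        prepend z (drop r r+ℓ<L path) (subst (λ x → Adj G z (u x)) (sym (+-identityʳ r)) z~uᵣ) z≁ z∉ ,
        on-path
    where
    r+ℓ<L : r + suc ℓ ≤ L
    r+ℓ<L = ≤-trans (≤-reflexive (+-suc r ℓ)) (≤-trans (+-monoˡ-≤ ℓ r<a) a+ℓ≤L)
    z≁ : ∀ {k} → suc k < suc ℓ → ¬ Adj G z (u (r + suc k))
    z≁ {k} (s≤s k<ℓ) with r + suc k <? a
    ... | yes r+k<a = none-above (m<m+n r (s≤s z≤n)) r+k<a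
    ... | no  r+k≮a = in-window (λ x → Adj G z (u x)) window
                        (≮⇒≥ r+k≮a) (<-≤-trans (+-monoˡ-< (suc k) r<a) (+-monoʳ-≤ a k<ℓ))
    z∉ : ∀ {k} → k < suc ℓ → z ≢ u (r + k)
    z∉ {k} k≤ℓ = z∉u (<-≤-trans (+-monoʳ-< r k≤ℓ) r+ℓ<L)
    on-path : ∀ {j} → j < suc ℓ → OnPath u L (u (r + j))
    on-path {j} j≤ℓ = r + j , <-≤-trans (+-monoʳ-< r j≤ℓ) r+ℓ<L , refl

  leg-beside-window : ∀ {u L z a ℓ i} → IsInducedPath u L → (∀ {x} → x < L → z ≢ u x) →
    (∀ {t} → t < ℓ → ¬ Adj G z (u (a + t))) → a + ℓ ≤ L → i < L → Adj G z (u i) →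
    Σ (ℕ → Fin n) λ B → Leg z B (suc ℓ) u L
  leg-beside-window {u} {z = z} {a} {ℓ} {i} path z∉u window a+ℓ≤L i<L z~uᵢ with a + ℓ ≤? i | a ≤? i
  ... | yes a+ℓ≤i | _       = leg-after-window path z∉u window a+ℓ≤i i<L z~uᵢ
  ... | no  a+ℓ≰i | yes a≤i = ⊥-elim (in-window (λ x → Adj G z (u x)) window a≤i (≰⇒> a+ℓ≰i) z~uᵢ)
  ... | no  _     | no a≰i  = leg-before-window path z∉u window a+ℓ≤L (≰⇒> a≰i) z~uᵢ

  leg-from-long-path : ∀ {d p u L z i} → ¬ ContainsInduced G (StarV d) (StarAdj d) →
    IsInducedPath u L → d * suc p ≤ L → (∀ {x} → x < L → z ≢ u x) → i < L → Adj G z (u i) →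
    Σ (ℕ → Fin n) λ B → Leg z B (suc p) u L
  leg-from-long-path {d} {p} {u} {L} {z} no-star path dp≤L z∉u i<L z~uᵢ
    with neighbour-free-block {w = suc p} {o = 0} z no-star path ≤-refl (m≤n⇒m≤1+n dp≤L)
  ... | b , b<d , window = leg-beside-window path z∉u window window-inside i<L z~uᵢ
    where
    window-inside : b * suc p + 0 + p ≤ L
    window-inside = begin
      b * suc p + 0 + p ≡⟨ cong (_+ p) (+-identityʳ (b * suc p)) ⟩
      b * suc p + p     ≤⟨ m≤n+m (b * suc p + p) 1 ⟩
      suc (b * suc p + p) ≡⟨ sym (+-suc (b * suc p) p) ⟩
      b * suc p + suc p ≡⟨ +-comm (b * suc p) (suc p) ⟩
      suc b * suc p     ≤⟨ *-monoˡ-≤ (suc p) b<d ⟩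
      d * suc p         ≤⟨ dp≤L ⟩
      L                 ∎
      where open ≤-Reasoning

  -- c i is the vertex at position i mod m of an induced cycle of length m.
  record IsCyclic (m : ℕ) (c : ℕ → Fin n) : Set where
    field
      step     : ∀ i → Adj G (c i) (c (suc i))
      periodic : ∀ i → c (m + i) ≡ c i
      arc      : ∀ q {L} → L < m → IsInducedPath (λ i → c (q + i)) L

  open IsCyclic public

  rotate : ∀ {m c} → IsCyclic m c → ∀ q → IsCyclic m (λ i → c (q + i))
  rotate {m} {c} cyc q = record
    { step     = λ i → subst (λ x → Adj G (c (q + i)) (c x)) (sym (+-suc q i)) (step cyc (q + i))
    ; periodic = λ i → trans (cong c (q+[m+i]≡m+[q+i] i)) (periodic cyc (q + i))
    ; arc      = λ q′ L<m → resp-≗ (λ i → cong c (+-assoc q q′ i)) (arc cyc (q + q′) L<m)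
    }
    where
    q+[m+i]≡m+[q+i] : ∀ i → q + (m + i) ≡ m + (q + i)
    q+[m+i]≡m+[q+i] i = trans (sym (+-assoc q m i)) (trans (cong (_+ i) (+-comm q m)) (+-assoc m q i))

  copy⇒cyclic : ∀ {m} .{{_ : NonZero m}} {C : Fin m → Fin n} → InducedCopy G (Fin m) (CycleAdj m) C →
                IsCyclic m (λ i → C (i mod m))
  copy⇒cyclic {m} {C} (C-inj , C-adj) = record
    { step     = step′
    ; periodic = λ i → cong C (toℕ-injective (begin
        toℕ ((m + i) mod m) ≡⟨ toℕ-fromℕ< _ ⟩
        (m + i) % m         ≡⟨ cong (_% m) (+-comm m i) ⟩
        (i + m) % m         ≡⟨ [m+n]%n≡m%n i m ⟩
        i % m               ≡⟨ sym (toℕ-fromℕ< _) ⟩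
        toℕ (i mod m)       ∎))
    ; arc      = arc′
    }
    where
    open ≡-Reasoning
    Next : Fin m → Fin m → Set
    Next a b = toℕ b ≡ suc (toℕ a) % m

    next⇒cycle-adj : ∀ a b → Next a b → CycleAdj m a b
    next⇒cycle-adj a b e with suc (toℕ a) <? m
    ... | yes 1+a<m = inj₁ (inj₁ (trans e (m<n⇒m%n≡m 1+a<m)))
    ... | no  1+a≮m = inj₂ (inj₂ (trans e (trans (cong (_% m) 1+a≡m) (n%n≡0 m)) , 1+a≡m))
      where
      1+a≡m : suc (toℕ a) ≡ m
      1+a≡m = ≤-antisym (toℕ<n a) (≮⇒≥ 1+a≮m)

    cycle-adj⇒next : ∀ a b → CycleAdj m a b → Next a b ⊎ Next b a
    cycle-adj⇒next a b (inj₁ (inj₁ e)) = inj₁ (trans e (sym (m<n⇒m%n≡m (subst (_< m) e (toℕ<n b)))))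
    cycle-adj⇒next a b (inj₁ (inj₂ e)) = inj₂ (trans e (sym (m<n⇒m%n≡m (subst (_< m) e (toℕ<n a)))))
    cycle-adj⇒next a b (inj₂ (inj₁ (a≡0 , 1+b≡m))) = inj₂ (trans a≡0 (sym (trans (cong (_% m) 1+b≡m) (n%n≡0 m))))
    cycle-adj⇒next a b (inj₂ (inj₂ (b≡0 , 1+a≡m))) = inj₁ (trans b≡0 (sym (trans (cong (_% m) 1+a≡m) (n%n≡0 m))))

    next-mod : ∀ x → Next (x mod m) (suc x mod m)
    next-mod x = begin
      toℕ (suc x mod m)          ≡⟨ toℕ-fromℕ< _ ⟩
      (1 + x) % m                ≡⟨ cong (_% m) (+-comm 1 x) ⟩
      (x + 1) % m                ≡⟨ sym (%-absorbˡ x 1) ⟩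
      (x % m + 1) % m            ≡⟨ cong (_% m) (+-comm (x % m) 1) ⟩
      suc (x % m) % m            ≡⟨ cong (λ t → suc t % m) (sym (toℕ-fromℕ< _)) ⟩
      suc (toℕ (x mod m)) % m    ∎

    step′ : ∀ i → Adj G (C (i mod m)) (C (suc i mod m))
    step′ i = proj₁ (C-adj _ _) (next⇒cycle-adj _ _ (next-mod i))

    next-index : ∀ q {i j} → suc i < m → j < m → Next ((q + i) mod m) ((q + j) mod m) → j ≡ suc i
    next-index q {i} {j} 1+i<m j<m e = %-injective-window q j<m 1+i<m (begin
      (q + j) % m                    ≡⟨ sym (toℕ-fromℕ< _) ⟩
      toℕ ((q + j) mod m)            ≡⟨ e ⟩
      suc (toℕ ((q + i) mod m)) % m  ≡⟨ sym (next-mod (q + i)) ⟩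
      toℕ (suc (q + i) mod m)        ≡⟨ cong (λ t → toℕ (t mod m)) (sym (+-suc q i)) ⟩
      toℕ ((q + suc i) mod m)        ≡⟨ toℕ-fromℕ< _ ⟩
      (q + suc i) % m                ∎)

    arc′ : ∀ q {L} → L < m → IsInducedPath (λ i → C ((q + i) mod m)) L
    arc′ q {L} L<m = record
      { adj⇒next  = λ {i} {j} i<L j<L a → [ inj₁ ∘ next-index q (≤-<-trans i<L L<m) (<-trans j<L L<m)
                                          , inj₂ ∘ next-index q (≤-<-trans j<L L<m) (<-trans i<L L<m) ]′
                                          (cycle-adj⇒next _ _ (proj₂ (C-adj _ _) a))
      ; next⇒adj  = λ {i} _ → subst (λ x → Adj G (C ((q + i) mod m)) (C (x mod m))) (sym (+-suc q i)) (step′ (q + i))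
      ; injective = λ {i} {j} i<L j<L e → %-injective-window q (<-trans i<L L<m) (<-trans j<L L<m)
          (trans (sym (toℕ-fromℕ< _)) (trans (cong toℕ (C-inj e)) (toℕ-fromℕ< _)))
      }

  -- A pendant path attached to a long induced cycle

  module Attached {m p′ : ℕ} {c : ℕ → Fin n} (cyc : IsCyclic m c) {y : Fin n} {B : ℕ → Fin n}
                  (leg : IsInducedPath (y ∷ B) (suc (suc p′)))
                  (B≁c : ∀ {k} → k < suc p′ → ∀ i → ¬ Adj G (B k) (c i)) where

    private
      p : ℕ
      p = suc p′

    B≢c : ∀ {k} → k < p → ∀ i → B k ≢ c i
    B≢c k<p i e = B≁c k<p (suc i) (subst (λ v → Adj G v (c (suc i))) (sym e) (step cyc i))

    y≢c : ∀ i → y ≢ c i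
    y≢c i e = B≁c (s≤s z≤n) i (adj-sym G (subst (λ v → Adj G v (B 0)) e (next⇒adj leg (s≤s (s≤s z≤n)))))

    separated-from-B : ∀ (g : ℕ → ℕ) → Separated p (λ k → c (g k)) B
    separated-from-B g _ j<p = (λ e → B≢c j<p _ (sym e)) , (λ a → B≁c j<p _ (adj-sym G a))

    separated-from-y∷B : ∀ (g : ℕ → ℕ) → (∀ {k} → k < p → ¬ Adj G y (c (g k))) →
                         Separated p (λ k → c (g k)) (y ∷ B)
    separated-from-y∷B g y≁ {k} {zero}  k<p _         = (λ e → y≢c _ (sym e)) , (λ a → y≁ k<p (adj-sym G a))
    separated-from-y∷B g y≁ {k} {suc j} k<p (s≤s j<p′) = separated-from-B g k<p (<-trans j<p′ (n<1+n p′))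

    c≢y∷B : ∀ i {k} → k < suc p → c i ≢ (y ∷ B) k
    c≢y∷B i {zero}  _         e = y≢c i (sym e)
    c≢y∷B i {suc k} (s≤s k<p) e = B≢c k<p i (sym e)

    touches-only-y : ∀ {i j} → j < p → Adj G (c i) ((y ∷ B) j) → j ≡ 0 × Adj G y (c i)
    touches-only-y {i} {zero}  _          a = refl , adj-sym G a
    touches-only-y {i} {suc j} (s≤s j<p′) a = ⊥-elim (B≁c (<-trans j<p′ (n<1+n p′)) i (adj-sym G a))

    spider-at-y : ∀ {M} → Adj G y (c 0) → Adj G y (c M) → (∀ {i} → 0 < i → i < M → ¬ Adj G y (c i)) →
                  p + p < M → suc M < m → ContainsInduced G (SV p) (SAdj p)
    spider-at-y {M} y~c₀ y~c_M gap 2p<M 1+M<m =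
      spider y c (λ k → c (M ∸ k)) B forward backward leg separated-arcs (separated-from-B (λ k → k))
             (separated-from-B (M ∸_))
      where
      p<M : p < M
      p<M = ≤-<-trans (m≤m+n p p) 2p<M
      p≤1+M : p ≤ suc M
      p≤1+M = ≤-trans (<⇒≤ p<M) (n≤1+n M)
      window : IsInducedPath c (suc M)
      window = arc cyc 0 1+M<m
      forward : IsInducedPath (y ∷ c) (suc p)
      forward = prepend y (restrict p≤1+M window) y~c₀
        (λ 1+k<p → gap (s≤s z≤n) (<-trans 1+k<p p<M)) (λ _ → y≢c _)
      backward : IsInducedPath (y ∷ λ k → c (M ∸ k)) (suc p)
      backward = prepend y (restrict p≤1+M (reverse M ≤-refl window)) y~c_M
        (λ 1+k<p → gap (m<n⇒0<n∸m (<-trans 1+k<p p<M)) (∸-monoʳ-< (s≤s z≤n) (<⇒≤ (<-trans 1+k<p p<M))))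
        (λ _ → y≢c _)
      apart : ∀ {k j} → k < p → j < p → suc k < M ∸ j
      apart {k} {j} (s≤s k≤p′) (s≤s j≤p′) = m+n≤o⇒m≤o∸n (suc (suc k)) (begin
        suc (suc k) + j ≤⟨ +-mono-≤ (s≤s (s≤s k≤p′)) j≤p′ ⟩
        suc p + p′      ≡⟨ cong suc (sym (+-suc p′ p′)) ⟩
        p + p           ≤⟨ <⇒≤ 2p<M ⟩
        M               ∎)
        where open ≤-Reasoning
      separated-arcs : Separated p c (λ k → c (M ∸ k))
      separated-arcs {k} {j} k<p j<p = index<⇒≢ window (<-trans (n<1+n _) (apart k<p j<p)) (s≤s (m∸n≤m M j))
                                     , nonconsecutive⇒¬adj window (apart k<p j<p) (s≤s (m∸n≤m M j))

    spider-at-cycle : Adj G y (c p) → (∀ {i} → i ≤ p + p → i ≢ p → ¬ Adj G y (c i)) → suc (p + p) < m →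
                      ContainsInduced G (SV p) (SAdj p)
    spider-at-cycle y~c_p y≁ 1+2p<m =
      spider (c p) (λ k → c (p′ ∸ k)) (λ k → c (suc p + k)) (y ∷ B) backward forward attachment
             separated-arcs (separated-from-y∷B (p′ ∸_) y≁before) (separated-from-y∷B (suc p +_) y≁after)
      where
      window : IsInducedPath c (suc (p + p))
      window = arc cyc 0 1+2p<m
      backward : IsInducedPath (c p ∷ λ k → c (p′ ∸ k)) (suc p)
      backward = resp-≗ (λ { zero → refl ; (suc k) → refl }) (reverse p (s≤s (m≤m+n p p)) window)
      forward : IsInducedPath (c p ∷ λ k → c (suc p + k)) (suc p)
      forward = resp-≗ (λ { zero → cong c (+-identityʳ p) ; (suc k) → cong c (+-suc p k) })
                       (drop p (≤-reflexive (+-suc p p)) window)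
      attachment : IsInducedPath (c p ∷ y ∷ B) (suc p)
      attachment = restrict (n≤1+n (suc p))
        (prepend (c p) leg (adj-sym G y~c_p) (λ 1+k<1+p a → B≁c (≤-pred 1+k<1+p) p (adj-sym G a)) (c≢y∷B p))
      separated-arcs : Separated p (λ k → c (p′ ∸ k)) (λ k → c (suc p + k))
      separated-arcs {k} {j} _ j<p = index<⇒≢ window (<-trans (n<1+n _) apart) inside , nonconsecutive⇒¬adj window apart inside
        where
        apart : suc (p′ ∸ k) < suc p + j
        apart = s≤s (s≤s (≤-trans (m∸n≤m p′ k) (m≤m+n p′ j)))
        inside : suc p + j < suc (p + p)
        inside = s≤s (+-monoʳ-< p j<p)
      y≁before : ∀ {k} → k < p → ¬ Adj G y (c (p′ ∸ k))
      y≁before {k} _ = y≁ (≤-trans (m∸n≤m p′ k) (≤-trans (n≤1+n p′) (m≤m+n p p)))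
                          (λ e → <-irrefl e (s≤s (m∸n≤m p′ k)))
      y≁after : ∀ {k} → k < p → ¬ Adj G y (c (suc p + k))
      y≁after {k} k<p = y≁ (+-monoʳ-< p k<p) (λ e → <-irrefl (sym e) (s≤s (m≤m+n p k)))

    triangle-at-y : Adj G y (c p′) → Adj G y (c p) → (∀ {i} → i ≤ p + p → i ≢ p′ → i ≢ p → ¬ Adj G y (c i)) →
                    suc (p + p) < m → ContainsInduced G (TV p) (TAdj p)
    triangle-at-y y~c_p′ y~c_p y≁ 1+2p<m =
      triangle (λ k → c (p′ ∸ k)) (λ k → c (p + k)) (y ∷ B) backward forward (restrict (n≤1+n p) leg)
               linked-arcs linked-before linked-after
      where
      window : IsInducedPath c (suc (p + p))
      window = arc cyc 0 1+2p<m
      backward : IsInducedPath (λ k → c (p′ ∸ k)) p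
      backward = reverse p′ (≤-trans (m≤m+n p p) (n≤1+n _)) window
      forward : IsInducedPath (λ k → c (p + k)) p
      forward = drop p (n≤1+n _) window
      before<p : ∀ k → p′ ∸ k < p
      before<p k = s≤s (m∸n≤m p′ k)
      after< : ∀ {j} → j < p → p + j < suc (p + p)
      after< j<p = <-trans (+-monoʳ-< p j<p) (n<1+n _)

      roots-only : ∀ {k j} → k < p → p + j ≡ suc (p′ ∸ k) → k ≡ 0 × j ≡ 0
      roots-only {k} {j} (s≤s k≤p′) e = k≡0 , j≡0
        where
        j≡0 : j ≡ 0
        j≡0 = n≤0⇒n≡0 (+-cancelˡ-≤ p j 0
                (subst (p + j ≤_) (sym (+-identityʳ p)) (≤-trans (≤-reflexive e) (before<p k))))
        k≡0 : k ≡ 0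
        k≡0 = sym (∸-cancelˡ-≡ z≤n k≤p′
                (suc-injective (trans (sym (+-identityʳ p)) (trans (cong (p +_) (sym j≡0)) e))))

      linked-arcs : Linked p (λ k → c (p′ ∸ k)) (λ k → c (p + k))
      linked-arcs = subst (λ i → Adj G (c p′) (c i)) (sym (+-identityʳ p)) (step cyc p′) , λ {k} {j} k<p j<p →
          index<⇒≢ window (≤-trans (before<p k) (m≤m+n p j)) (after< j<p)
        , λ a → [ roots-only k<p
                , (λ e → ⊥-elim (<-irrefl e (<-≤-trans (before<p k) (≤-trans (m≤m+n p j) (n≤1+n _))))) ]′
                  (adj⇒next window (<-trans (before<p k) (s≤s (m≤m+n p p))) (after< j<p) a)

      y~before⇒root : ∀ {k} → k < p → Adj G y (c (p′ ∸ k)) → k ≡ 0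
      y~before⇒root {k} (s≤s k≤p′) a with p′ ∸ k ≟ p′
      ... | yes e = sym (∸-cancelˡ-≡ z≤n k≤p′ (sym e))
      ... | no  ≢p′ = ⊥-elim (y≁ (≤-trans (<⇒≤ (before<p k)) (m≤m+n p p)) ≢p′ (λ e → <-irrefl e (before<p k)) a)

      y~after⇒root : ∀ {k} → k < p → Adj G y (c (p + k)) → k ≡ 0
      y~after⇒root {k} k<p a with p + k ≟ p
      ... | yes e = +-cancelˡ-≡ p k 0 (trans e (sym (+-identityʳ p)))
      ... | no  ≢p = ⊥-elim (y≁ (<⇒≤ (+-monoʳ-< p k<p)) (λ e → <-irrefl (sym e) (s≤s (m≤m+n p′ k))) ≢p a)

      linked-before : Linked p (λ k → c (p′ ∸ k)) (y ∷ B)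
      linked-before = adj-sym G y~c_p′ , λ {k} k<p j<p →
          c≢y∷B _ (<-trans j<p (n<1+n p))
        , λ a → let j≡0 , y~c = touches-only-y j<p a in y~before⇒root k<p y~c , j≡0

      linked-after : Linked p (λ k → c (p + k)) (y ∷ B)
      linked-after = subst (λ i → Adj G (c i) y) (sym (+-identityʳ p)) (adj-sym G y~c_p) , λ {k} k<p j<p →
          c≢y∷B _ (<-trans j<p (n<1+n p))
        , λ a → let j≡0 , y~c = touches-only-y j<p a in y~after⇒root k<p y~c , j≡0

  period : ∀ {m c} → IsCyclic m c → c m ≡ c 0
  period {m} {c} cyc = trans (cong c (sym (+-identityʳ m))) (periodic cyc 0)

  wrapped-gap : ∀ {m M p c y} → IsCyclic m c → (∀ {i} → 0 < i → i < M → ¬ Adj G y (c i)) → p < M → M ≤ m →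
    ∀ {i} → i ≤ p + p → i ≢ p → (i < p → m ∸ p + i < M) → ¬ Adj G y (c (m ∸ p + i))
  wrapped-gap {m} {M} {p} {c} {y} cyc gap p<M M≤m {i} i≤2p i≢p below with <-cmp i p
  ... | tri< i<p _ _ = gap (≤-trans (m<n⇒0<n∸m (<-≤-trans p<M M≤m)) (m≤m+n (m ∸ p) i)) (below i<p)
  ... | tri≈ _ i≡p _ = ⊥-elim (i≢p i≡p)
  ... | tri> _ _ p<i = subst (λ v → ¬ Adj G y v) (sym wrap)
                         (gap (m<n⇒0<n∸m p<i) (≤-<-trans (m≤n+o⇒m∸n≤o i p i≤2p) p<M))
    where
    wrap : c (m ∸ p + i) ≡ c (i ∸ p)
    wrap = begin
      c (m ∸ p + i)             ≡⟨ cong (λ x → c (m ∸ p + x)) (sym (m+[n∸m]≡n (<⇒≤ p<i))) ⟩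
      c (m ∸ p + (p + (i ∸ p))) ≡⟨ cong c (sym (+-assoc (m ∸ p) p (i ∸ p))) ⟩
      c (m ∸ p + p + (i ∸ p))   ≡⟨ cong (λ x → c (x + (i ∸ p))) (m∸n+n≡m (<⇒≤ (<-≤-trans p<M M≤m))) ⟩
      c (m + (i ∸ p))           ≡⟨ periodic cyc (i ∸ p) ⟩
      c (i ∸ p)                 ∎
      where open ≡-Reasoning

  module _ {m p′ : ℕ} {c : ℕ → Fin n} (cyc : IsCyclic m c) {y : Fin n} {B : ℕ → Fin n}
           (leg : IsInducedPath (y ∷ B) (suc (suc p′)))
           (B≁c : ∀ {k} → k < suc p′ → ∀ i → ¬ Adj G (B k) (c i)) where

    private
      p : ℕ
      p = suc p′
      module Around = Attached (rotate cyc (m ∸ p)) leg (λ k<p _ → B≁c k<p _)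

    centred : p ≤ m → Adj G y (c 0) → Adj G y (c (m ∸ p + p))
    centred p≤m y~c₀ = subst (λ i → Adj G y (c i)) (sym (m∸n+n≡m p≤m)) (subst (Adj G y) (sym (period cyc)) y~c₀)

    single-neighbour : Adj G y (c 0) → (∀ {i} → 0 < i → i < m → ¬ Adj G y (c i)) → suc (p + p) < m →
                       ContainsInduced G (SV p) (SAdj p)
    single-neighbour y~c₀ gap 1+2p<m = Around.spider-at-cycle (centred p≤m y~c₀) y≁ 1+2p<m
      where
      p≤m : p ≤ m
      p≤m = ≤-trans (m≤m+n p p) (≤-trans (n≤1+n _) (<⇒≤ 1+2p<m))
      y≁ : ∀ {i} → i ≤ p + p → i ≢ p → ¬ Adj G y (c (m ∸ p + i))
      y≁ i≤2p i≢p = wrapped-gap cyc gap (<-≤-trans (s≤s (m≤m+n p p)) (<⇒≤ 1+2p<m)) ≤-refl i≤2p i≢p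
        (λ i<p → <-≤-trans (+-monoʳ-< (m ∸ p) i<p) (≤-reflexive (m∸n+n≡m p≤m)))

    adjacent-neighbours : ∀ {M} → Adj G y (c 0) → Adj G y (c M) → suc M ≡ m →
      (∀ {i} → 0 < i → i < M → ¬ Adj G y (c i)) → suc (p + p) < m → ContainsInduced G (TV p) (TAdj p)
    adjacent-neighbours {M} y~c₀ y~c_M 1+M≡m gap 1+2p<m =
      Around.triangle-at-y (subst (λ i → Adj G y (c i)) (sym m∸p+p′≡M) y~c_M) (centred p≤m y~c₀) y≁ 1+2p<m
      where
      p<M : p < M
      p<M = ≤-<-trans (m≤m+n p p) (≤-pred (subst (suc (p + p) <_) (sym 1+M≡m) 1+2p<m))
      p≤m : p ≤ m
      p≤m = ≤-trans (<⇒≤ p<M) (≤-trans (n≤1+n M) (≤-reflexive 1+M≡m))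
      m∸p+p′≡M : m ∸ p + p′ ≡ M
      m∸p+p′≡M = suc-injective (trans (sym (+-suc (m ∸ p) p′)) (trans (m∸n+n≡m p≤m) (sym 1+M≡m)))
      y≁ : ∀ {i} → i ≤ p + p → i ≢ p′ → i ≢ p → ¬ Adj G y (c (m ∸ p + i))
      y≁ i≤2p i≢p′ i≢p = wrapped-gap cyc gap p<M (≤-trans (n≤1+n M) (≤-reflexive 1+M≡m)) i≤2p i≢p
        (λ i<p → subst (m ∸ p + _ <_) m∸p+p′≡M (+-monoʳ-< (m ∸ p) (≤∧≢⇒< (≤-pred i<p) i≢p′)))

    neighbours-around-gap : ∀ {M} → ¬ ContainsInduced G (SV p) (SAdj p) → ¬ ContainsInduced G (TV p) (TAdj p) →
      Adj G y (c 0) → Adj G y (c M) → (∀ {i} → 0 < i → i < M → ¬ Adj G y (c i)) →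
      p + p < M → M ≤ m → suc (p + p) < m → ⊥
    neighbours-around-gap {M} no-S no-T y~c₀ y~c_M gap 2p<M M≤m 1+2p<m with m≤n⇒m<n∨m≡n M≤m
    ... | inj₂ refl = no-S (single-neighbour y~c₀ gap 1+2p<m)
    ... | inj₁ M<m with m≤n⇒m<n∨m≡n M<m
    ...   | inj₁ 1+M<m = no-S (Attached.spider-at-y cyc leg B≁c y~c₀ y~c_M gap 2p<M 1+M<m)
    ...   | inj₂ 1+M≡m = no-T (adjacent-neighbours y~c₀ y~c_M 1+M≡m gap 1+2p<m)

  module _ {d p′ m′ : ℕ} (0<d : 0 < d) (bound : d * (2 * suc p′ + 2) ≤ suc m′) where

    private
      p w : ℕ
      p = suc p′
      w = suc (suc (p + p))

      dw≤m : d * w ≤ suc m′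
      dw≤m = subst (λ x → d * x ≤ suc m′) (trans (+-comm (2 * p) 2) (cong (λ x → 2 + (p + x)) (+-identityʳ p))) bound

      w≤m : w ≤ suc m′
      w≤m = ≤-trans (≤-reflexive (sym (*-identityˡ w))) (≤-trans (*-monoˡ-≤ w 0<d) dw≤m)

      window-inside : ∀ {b} → b < d → b * w + 1 + (p + p) ≤ suc m′
      window-inside {b} b<d = begin
        b * w + 1 + (p + p)   ≡⟨ +-assoc (b * w) 1 (p + p) ⟩
        b * w + suc (p + p)   <⟨ +-monoʳ-< (b * w) ≤-refl ⟩
        b * w + w             ≡⟨ +-comm (b * w) w ⟩
        suc b * w             ≤⟨ *-monoˡ-≤ w b<d ⟩
        d * w                 ≤⟨ dw≤m ⟩
        suc m′                ∎
        where open ≤-Reasoning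

    long-cycle-with-attached-leg : ∀ {c y B} →
      ¬ ContainsInduced G (StarV d) (StarAdj d) →
      ¬ ContainsInduced G (SV p) (SAdj p) → ¬ ContainsInduced G (TV p) (TAdj p) →
      IsCyclic (suc m′) c → IsInducedPath (y ∷ B) (suc p) → (∀ {k} → k < p → ∀ i → ¬ Adj G (B k) (c i)) →
      Adj G y (c 0) → ⊥
    long-cycle-with-attached-leg {c} {y} no-K no-S no-T cyc leg B≁c y~c₀
      with neighbour-free-block {w = w} {o = 1} {ℓ = p + p} y no-K (arc cyc 0 ≤-refl) ≤-refl dw≤m
    ... | b , b<d , window
      with enclosing-gap (λ j → adj? G y (c j)) y~c₀ (subst (Adj G y) (sym (period cyc)) y~c₀)
                         window (m≤n+m 1 (b * w)) (window-inside b<d)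
    ... | e , M , y~c_e , y~c_e+M , 2p<M , e+M≤m , gap =
      neighbours-around-gap (rotate cyc e) leg (λ k<p _ → B≁c k<p _) no-S no-T
        (subst (λ i → Adj G y (c i)) (sym (+-identityʳ e)) y~c_e) y~c_e+M gap 2p<M
        (≤-trans (m≤n+m M e) e+M≤m) w≤m

  -- Descending along a shortest walk

  Reaches : (Fin n → Set) → ℕ → Fin n → Set
  Reaches S zero    v = S v
  Reaches S (suc t) v = Σ (Fin n) λ w → Adj G v w × Reaches S t w

  reaches? : ∀ {S} → Decidable S → ∀ t → Decidable (Reaches S t)
  reaches? S? zero    v = S? v
  reaches? S? (suc t) v = any? (λ w → adj? G v w ×-dec reaches? S? t w)

  walk⇒reaches : ∀ {S u v} → Star (Adj G) u v → S v → Σ ℕ λ t → Reaches S t u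
  walk⇒reaches ε        v∈S = 0 , v∈S
  walk⇒reaches (e ◅ es) v∈S with walk⇒reaches es v∈S
  ... | t , r = suc t , _ , e , r

  descend : ∀ {S p s v B} → Reaches S (suc s) v → (∀ {t} → t ≤ s → ¬ Reaches S t v) →
    IsInducedPath (v ∷ B) (suc p) → (∀ {k} → k < p → ∀ {t} → t ≤ suc s → ¬ Reaches S t (B k)) →
    Σ (Fin n) λ y → Σ (ℕ → Fin n) λ B′ →
      IsInducedPath (y ∷ B′) (suc p) × Reaches S 1 y × (∀ {k} → k < p → ¬ Reaches S 1 (B′ k))
  descend {s = zero}  {v} {B} v→S _ leg B-far = v , B , leg , v→S , λ k<p → B-far k<p ≤-refl
  descend {S} {p} {suc s} {v} {B} (w , v~w , w→S) v-far leg B-far =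
    descend w→S w-far (restrict (n≤1+n (suc p)) (prepend w leg (adj-sym G v~w) w≁B w∉)) v∷B-far
    where
    w-far : ∀ {t} → t ≤ s → ¬ Reaches S t w
    w-far t≤s w→S′ = v-far (s≤s t≤s) (w , v~w , w→S′)
    w≁B : ∀ {k} → suc k < suc p → ¬ Adj G w (B k)
    w≁B (s≤s k<p) w~B = B-far k<p ≤-refl (w , adj-sym G w~B , w→S)
    w∉ : ∀ {k} → k < suc p → w ≢ (v ∷ B) k
    w∉ {zero}  _         refl = irrefl G v~w
    w∉ {suc k} (s≤s k<p) refl = B-far k<p (n≤1+n _) w→S
    v∷B-far : ∀ {k} → k < p → ∀ {t} → t ≤ suc s → ¬ Reaches S t ((v ∷ B) k)
    v∷B-far {zero}  _          t≤ = v-far t≤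
    v∷B-far {suc k} (s≤s k<p′) t≤ = B-far (<-trans k<p′ (n<1+n _)) (m≤n⇒m≤1+n t≤)

  attached-leg : ∀ {S d p u L} → Decidable S → ¬ ContainsInduced G (StarV d) (StarAdj d) →
    IsInducedPath u L → d * suc p ≤ L → (∀ {x} → x < L → ¬ S (u x) × ¬ Reaches S 1 (u x)) →
    ∀ {t x} → x < L → Reaches S t (u x) →
    Σ (Fin n) λ y → Σ (ℕ → Fin n) λ B →
      IsInducedPath (y ∷ B) (suc (suc p)) × Reaches S 1 y × (∀ {k} → k < suc p → ¬ Reaches S 1 (B k))
  attached-leg {S} {d} {p} {u} {L} S? no-K path dp≤L off {t} {x} x<L x→S
    with least-in-range (λ t → anyUpTo? (λ x → reaches? S? t (u x)) L) {s = t} (x , x<L , x→S) z≤n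
  ... | zero , _ , _ , (x′ , x′<L , x′∈S) , _ = ⊥-elim (proj₁ (off x′<L) x′∈S)
  ... | suc zero , _ , _ , (x′ , x′<L , x′→S) , _ = ⊥-elim (proj₂ (off x′<L) x′→S)
  ... | suc (suc s) , _ , _ , (x′ , x′<L , (z , x′~z , z→S)) , closer-none
    with leg-from-long-path no-K path dp≤L z∉u x′<L (adj-sym G x′~z)
    where
    z∉u : ∀ {x} → x < L → z ≢ u x
    z∉u x<L refl = closer-none z≤n (s≤s (n<1+n s)) (_ , x<L , z→S)
  ...   | B , leg , on-path = descend z→S z-far leg B-far
    where
    z-far : ∀ {t} → t ≤ s → ¬ Reaches S t z
    z-far t≤s z→S′ = closer-none z≤n (s≤s (s≤s t≤s)) (x′ , x′<L , z , x′~z , z→S′)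
    B-far : ∀ {k} → k < suc p → ∀ {t} → t ≤ suc s → ¬ Reaches S t (B k)
    B-far k<p {t} t≤ B→S with on-path k<p
    ... | x″ , x″<L , B≡u = closer-none z≤n (s≤s t≤) (x″ , x″<L , subst (Reaches S t) B≡u B→S)

lemma4p3 : (d p : ℕ) → 1 ≤ d → 1 ≤ p →
    {n : ℕ} (G : Graph n) → Connected G →
    ¬ ContainsInduced G (StarV d) (StarAdj d) →
    ¬ ContainsInduced G (SV p) (SAdj p) →
    ¬ ContainsInduced G (TV p) (TAdj p) →
    (k : ℕ) (P : Fin k → Fin n) → InducedCopy G (Fin k) (PathAdj k) P →
    d * p ≤ k →
    ¬ (Σ ℕ λ m → d * (2 * p + 2) ≤ m × Σ (Fin m → Fin n) λ C →
         InducedCopy G (Fin m) (CycleAdj m) C ×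
         ((j : Fin m) → ¬ InClosedNbhd G P (C j)))
lemma4p3 (suc d′) (suc p′) _ _ G _ _ _ _ k P _ _ (zero , () , _)
lemma4p3 (suc d′) (suc p′) 0<d _ {n} G connected no-K no-S no-T k P P-path dp≤k (suc m′ , bound , C , C-cycle , off)
  with attached-leg G on-cycle? no-K (copy⇒path G v₀ P-path) dp≤k off-cycle {t = proj₁ start} 0<k
         (subst (Reaches G OnCycle (proj₁ start)) (sym (extend-< v₀ P 0<k)) (proj₂ start))
  where
  OnCycle : Fin n → Set
  OnCycle v = Σ (Fin (suc m′)) λ i → v ≡ C i
  on-cycle? : Decidable OnCycle
  on-cycle? v = any? (λ i → v ≟ᶠ C i)
  0<k : 0 < k
  0<k = ≤-trans (s≤s z≤n) dp≤k
  v₀ : Fin n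
  v₀ = P (fromℕ< 0<k)
  start : Σ ℕ λ t → Reaches G OnCycle t v₀
  start = walk⇒reaches G (connected v₀ (C zero)) (zero , refl)
  off-cycle : ∀ {x} → x < k → ¬ OnCycle (extend v₀ P x) × ¬ Reaches G OnCycle 1 (extend v₀ P x)
  off-cycle {x} x<k =
      (λ { (i , e) → off i (fromℕ< x<k , inj₁ (trans (sym e) (extend-< v₀ P x<k))) })
    , (λ { (_ , a , i , refl) →
             off i (fromℕ< x<k , inj₂ (adj-sym G (subst (λ v → Adj G v (C i)) (extend-< v₀ P x<k) a))) })
... | y , B , leg , (_ , y~c , i , refl) , B-far =
  long-cycle-with-attached-leg G 0<d bound no-K no-S no-T (rotate G (copy⇒cyclic G C-cycle) (toℕ i)) leg
    (λ k<p _ a → B-far k<p (_ , a , _ , refl))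
    (subst (λ j → Adj G y (C j)) (sym (toℕ+0-mod i)) y~c)
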